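{- For any graph $G$ and any positive integers $t$ and $n$, \[\left\lceil \frac{n}{n+1}\,\pi^*_{2t}(G)\right\rceil \le \pi_t^*(G\Box K_n)\le \pi^*_{2t}(G).\]
   Context: Graphs are finite simple graphs. A distribution on a graph $G=(V,E)$ is a function $D:V\to\mathbb{N}$, with size $|D|=\sum_v D(v)$. A pebbling move removes two pebbles from a vertex having at least two pebbles and places one pebble on a neighbor. A distribution $D$ is $t$-solvable if for every vertex $v$, some sequence of pebbling moves starting from $D$ results in a distribution with at least $t$ pebbles on $v$. The optimal $t$-pebbling number $\pi_t^*(G)$ is the minimum size of a $t$-solvable distribution on $G$. $K_n$ is the complete graph on $n$ vertices and $G\Box H$ denotes the Cartesian product of graphs. -}

module Defs where

open import Data.Nat using (ℕ; zero; suc; _+_; _*_; _∸_; _≤_; _/_)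
open import Data.Fin using (Fin; remQuot; _≟_)
open import Data.Product using (Σ; ∃; _×_; _,_; proj₁; proj₂)
open import Data.Sum using (_⊎_)
open import Data.Vec using (tabulate; sum)
open import Relation.Nullary using (¬_; yes; no)
open import Relation.Binary.PropositionalEquality using (_≡_; _≢_; sym)
open import Relation.Binary.Construct.Closure.ReflexiveTransitive using (Star)

record Graph : Set₁ where
  field
    order  : ℕ
    Adj    : Fin order → Fin order → Set
    adj-sym    : ∀ {u v} → Adj u v → Adj v u
    irrefl : ∀ {u} → ¬ Adj u u
open Graph public

K : ℕ → Graph
K n = record { order = n ; Adj = λ i j → i ≢ j
             ; adj-sym = λ p q → p (sym q) ; irrefl = λ p → p _≡_.refl }

-- Cartesian product G □ H on vertex set Fin (|G| * |H|) ≅ Fin |G| × Fin |H| (via remQuot)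
ProdAdj : (G H : Graph) → Fin (order G) × Fin (order H) → Fin (order G) × Fin (order H) → Set
ProdAdj G H (a , b) (a' , b') = (a ≡ a' × Adj H b b') ⊎ (Adj G a a' × b ≡ b')

_□_ : Graph → Graph → Graph
G □ H = record
  { order = order G * order H
  ; Adj = λ x y → ProdAdj G H (remQuot (order H) x) (remQuot (order H) y)
  ; adj-sym = λ { (Data.Sum.inj₁ (e , p)) → Data.Sum.inj₁ (sym e , Graph.adj-sym H p)
            ; (Data.Sum.inj₂ (p , e)) → Data.Sum.inj₂ (Graph.adj-sym G p , sym e) }
  ; irrefl = λ { (Data.Sum.inj₁ (_ , p)) → Graph.irrefl H p
               ; (Data.Sum.inj₂ (p , _)) → Graph.irrefl G p }
  }

Distribution : Graph → Set
Distribution G = Fin (order G) → ℕ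

size : (G : Graph) → Distribution G → ℕ
size G D = sum (tabulate D)

move : (G : Graph) → Fin (order G) → Fin (order G) → Distribution G → Distribution G
move G u v D w with w ≟ u | w ≟ v
... | yes _ | yes _ = D w ∸ 2 + 1
... | yes _ | no  _ = D w ∸ 2
... | no  _ | yes _ = D w + 1
... | no  _ | no  _ = D w

data Step (G : Graph) (D : Distribution G) : Distribution G → Set where
  step : ∀ u v → Adj G u v → 2 ≤ D u → Step G D (move G u v D)

Reach : (G : Graph) → Distribution G → Distribution G → Set
Reach G = Star (Step G)

Solvable : (G : Graph) → ℕ → Distribution G → Set
Solvable G t D = ∀ v → ∃ λ D' → Reach G D D' × t ≤ D' v

-- p is the optimal t-pebbling number π*_t(G): the minimum size of a t-solvable distribution
IsOptPebbling : Graph → ℕ → ℕ → Set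
IsOptPebbling G t p =
  (∃ λ D → Solvable G t D × size G D ≡ p) × (∀ D → Solvable G t D → p ≤ size G D)

⌈_/suc_⌉ : ℕ → ℕ → ℕ
⌈ a /suc c ⌉ = (a + c) / suc c

-- Upper bound: place a 2t-solvable distribution of G on the layer G × {0}. Moves of G are
-- performed inside that layer, and 2t pebbles on (v, 0) send t pebbles to any (v, b).
--
-- Lower bound: for a t-solvable distribution E of G □ Kₙ and a layer i, the projection
-- D a = E (a, i) + Σ_b E (a, b) is 2t-solvable on G: every move of G □ Kₙ is simulated,
-- up to discarding pebbles, by at most two moves of G on the projections, and t pebbles
-- on (v, i) project to at least 2t on v. Its size is |E| plus the size of layer i; for the
-- lightest layer this is at most (n + 1)/n · |E|.
module Submission where

open import Defs
open import Data.Nat using (ℕ; zero; suc; _+_; _*_; _∸_; _≤_; z≤n; s≤s⁻¹; _≤?_)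
open import Data.Nat.Properties hiding (_≟_)
open import Data.Nat.DivMod using (m<n*o⇒m/o<n)
open import Data.Fin using (Fin; zero; suc; combine; remQuot; _↑ˡ_; _↑ʳ_; _≟_)
open import Data.Fin.Properties using (punchInᵢ≢i; remQuot-combine; combine-remQuot; combine-injective)
open import Data.Vec as Vec using (tabulate)
open import Data.Vec.Functional using (removeAt; updateAt)
open import Data.Vec.Functional.Properties using (updateAt-updates; updateAt-minimal)
open import Data.Product using (∃; _×_; _,_; proj₁; proj₂; uncurry)
open import Data.Sum using (inj₁; inj₂)
open import Function using (_∘_)
open import Relation.Nullary using (Dec; yes; no; contradiction)
open import Relation.Binary.PropositionalEquality
open import Relation.Binary.Construct.Closure.ReflexiveTransitive using (ε; _◅_; _◅◅_)
open import Data.Nat.Tactic.RingSolver using (solve-∀)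
open import Algebra.Properties.CommutativeSemigroup +-commutativeSemigroup using (xy∙z≈xz∙y)
open import Algebra.Properties.CommutativeMonoid.Sum +-0-commutativeMonoid
  using (sum; sum-syntax; sum-cong-≗; sum-remove; sum-replicate-zero; ∑-distrib-+; ∑-comm)

sum-tabulate : ∀ {n} (f : Fin n → ℕ) → Vec.sum (tabulate f) ≡ sum f
sum-tabulate {zero}  f = refl
sum-tabulate {suc n} f = cong (f zero +_) (sum-tabulate (f ∘ suc))

sum-mono-≤ : ∀ {n} {f g : Fin n → ℕ} → (∀ i → f i ≤ g i) → sum f ≤ sum g
sum-mono-≤ {zero}  f≤g = z≤n
sum-mono-≤ {suc n} f≤g = +-mono-≤ (f≤g zero) (sum-mono-≤ (f≤g ∘ suc))

sum-const : ∀ n c → sum {n} (λ _ → c) ≡ n * c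
sum-const zero    c = refl
sum-const (suc n) c = cong (c +_) (sum-const n c)

≤-sum : ∀ {n} (f : Fin (suc n) → ℕ) i → f i ≤ sum f
≤-sum f i = ≤-trans (m≤m+n (f i) _) (≤-reflexive (sym (sum-remove {i = i} f)))

sum-↑ : ∀ m {n} (f : Fin (m + n) → ℕ) → sum f ≡ sum (f ∘ (_↑ˡ n)) + sum (f ∘ (m ↑ʳ_))
sum-↑ zero    f = refl
sum-↑ (suc m) f = trans (cong (f zero +_) (sum-↑ m (f ∘ suc))) (sym (+-assoc (f zero) _ _))

sum-combine : ∀ m {n} (f : Fin (m * n) → ℕ) →
  sum f ≡ ∑[ a < m ] ∑[ b < n ] f (combine a b)
sum-combine zero        f = refl
sum-combine (suc m) {n} f =
  trans (sum-↑ n f) (cong (sum (f ∘ (_↑ˡ m * n)) +_) (sum-combine m (f ∘ (n ↑ʳ_))))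

∃-minimum : ∀ {n} (f : Fin (suc n) → ℕ) → ∃ λ i → ∀ j → f i ≤ f j
∃-minimum {zero}  f = zero , λ { zero → ≤-refl }
∃-minimum {suc n} f with ∃-minimum (f ∘ suc)
... | i , fi≤ with f zero ≤? f (suc i)
...   | yes f0≤fi = zero  , λ { zero → ≤-refl ; (suc j) → ≤-trans f0≤fi (fi≤ j) }
...   | no  f0≰fi = suc i , λ { zero → <⇒≤ (≰⇒> f0≰fi) ; (suc j) → fi≤ j }

∃-≤-average : ∀ {n} (f : Fin (suc n) → ℕ) → ∃ λ i → suc n * f i ≤ sum f
∃-≤-average {n} f with ∃-minimum f
... | i , fi≤ = i , subst (_≤ sum f) (sum-const (suc n) (f i)) (sum-mono-≤ fi≤)

sum-update-≤ : ∀ {n} {f g : Fin (suc n) → ℕ} (i : Fin (suc n)) {k l} →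
  (∀ j → j ≢ i → g j ≤ f j) → g i + k ≤ f i + l → sum g + k ≤ sum f + l
sum-update-≤ {f = f} {g} i {k} {l} g≤f gi≤fi = begin
  sum g + k                           ≡⟨ cong (_+ k) (sum-remove {i = i} g) ⟩
  g i + sum (removeAt g i) + k        ≡⟨ xy∙z≈xz∙y (g i) _ k ⟩
  g i + k + sum (removeAt g i)        ≤⟨ +-mono-≤ gi≤fi (sum-mono-≤ (λ j → g≤f _ (punchInᵢ≢i i j))) ⟩
  f i + l + sum (removeAt f i)        ≡⟨ xy∙z≈xz∙y (f i) l _ ⟩
  f i + sum (removeAt f i) + l        ≡⟨ cong (_+ l) (sum-remove {i = i} f) ⟨
  sum f + l                           ∎
  where open ≤-Reasoning

sum-update₂-≤ : ∀ {n} {f g : Fin (suc n) → ℕ} {i i'} {k l} → i ≢ i' →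
  (∀ j → j ≢ i → j ≢ i' → g j ≤ f j) → g i + k ≤ f i → g i' ≤ f i' + l → sum g + k ≤ sum f + l
sum-update₂-≤ {f = f} {g} {i} {i'} {k} {l} i≢i' g≤f gi gi' = begin
  sum g + k       ≡⟨ cong (_+ k) (+-identityʳ (sum g)) ⟨
  sum g + 0 + k   ≤⟨ +-monoˡ-≤ k (sum-update-≤ i' g≤h gi'≤hi') ⟩
  sum h + l + k   ≡⟨ xy∙z≈xz∙y (sum h) l k ⟩
  sum h + k + l   ≤⟨ +-monoˡ-≤ l (sum-update-≤ i h≤f hi≤fi) ⟩
  sum f + 0 + l   ≡⟨ cong (_+ l) (+-identityʳ (sum f)) ⟩
  sum f + l       ∎
  where
  open ≤-Reasoning
  h : Fin (suc _) → ℕ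
  h = updateAt f i (λ _ → g i)
  hi : h i ≡ g i
  hi = updateAt-updates i f
  h-other : ∀ j → j ≢ i → h j ≡ f j
  h-other j j≢i = updateAt-minimal j i f j≢i
  g≤h : ∀ j → j ≢ i' → g j ≤ h j
  g≤h j j≢i' with j ≟ i
  ... | yes refl = ≤-reflexive (sym hi)
  ... | no  j≢i  = subst (g j ≤_) (sym (h-other j j≢i)) (g≤f j j≢i j≢i')
  gi'≤hi' : g i' + 0 ≤ h i' + l
  gi'≤hi' rewrite +-identityʳ (g i') | h-other i' (i≢i' ∘ sym) = gi'
  hi≤fi : h i + k ≤ f i + 0
  hi≤fi rewrite hi | +-identityʳ (f i) = gi
  h≤f : ∀ j → j ≢ i → h j ≤ f j
  h≤f j j≢i = ≤-reflexive (h-other j j≢i)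

infix 4 _≤ᴰ_
_≤ᴰ_ : ∀ {n} → (Fin n → ℕ) → (Fin n → ℕ) → Set
D ≤ᴰ E = ∀ w → D w ≤ E w

module _ (G : Graph) where

  adj⇒≢ : ∀ {u v} → Adj G u v → u ≢ v
  adj⇒≢ uv refl = irrefl G uv

  module _ {u v : Fin (order G)} (D : Distribution G) where

    move-source : u ≢ v → move G u v D u ≡ D u ∸ 2
    move-source u≢v with u ≟ u | u ≟ v
    ... | yes _   | yes u≡v = contradiction u≡v u≢v
    ... | yes _   | no _    = refl
    ... | no u≢u  | _       = contradiction refl u≢u

    move-target : u ≢ v → move G u v D v ≡ D v + 1
    move-target u≢v with v ≟ u | v ≟ v
    ... | yes v≡u | _       = contradiction (sym v≡u) u≢v
    ... | no _    | yes _   = refl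
    ... | no _    | no v≢v  = contradiction refl v≢v

    move-other : ∀ {w} → w ≢ u → w ≢ v → move G u v D w ≡ D w
    move-other {w} w≢u w≢v with w ≟ u | w ≟ v
    ... | yes w≡u | _       = contradiction w≡u w≢u
    ... | no _    | yes w≡v = contradiction w≡v w≢v
    ... | no _    | no _    = refl

    move-≤-+1 : ∀ w → move G u v D w ≤ D w + 1
    move-≤-+1 w with w ≟ u | w ≟ v
    ... | yes _ | yes _ = +-monoˡ-≤ 1 (m∸n≤m (D w) 2)
    ... | yes _ | no  _ = ≤-trans (m∸n≤m (D w) 2) (m≤m+n (D w) 1)
    ... | no  _ | yes _ = ≤-refl
    ... | no  _ | no  _ = m≤m+n (D w) 1

  move-mono-≤ : ∀ {u v D E} → D ≤ᴰ E → move G u v D ≤ᴰ move G u v E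
  move-mono-≤ {u} {v} D≤E w with w ≟ u | w ≟ v
  ... | yes _ | yes _ = +-monoˡ-≤ 1 (∸-monoˡ-≤ 2 (D≤E w))
  ... | yes _ | no  _ = ∸-monoˡ-≤ 2 (D≤E w)
  ... | no  _ | yes _ = +-monoˡ-≤ 1 (D≤E w)
  ... | no  _ | no  _ = D≤E w

  reach-mono-≤ : ∀ {D E D'} → D ≤ᴰ E → Reach G D D' → ∃ λ E' → Reach G E E' × D' ≤ᴰ E'
  reach-mono-≤ D≤E ε = _ , ε , D≤E
  reach-mono-≤ D≤E (step u v uv 2≤Du ◅ D↝D') with reach-mono-≤ (move-mono-≤ D≤E) D↝D'
  ... | E' , E↝E' , D'≤E' = E' , step u v uv (≤-trans 2≤Du (D≤E u)) ◅ E↝E' , D'≤E'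

  WeakReach : Distribution G → Distribution G → Set
  WeakReach D F = ∃ λ D' → Reach G D D' × F ≤ᴰ D'

  weakReach-≤ᴰ : ∀ {D F} → F ≤ᴰ D → WeakReach D F
  weakReach-≤ᴰ F≤D = _ , ε , F≤D

  weakReach-trans : ∀ {D F H} → WeakReach D F → WeakReach F H → WeakReach D H
  weakReach-trans (D' , D↝D' , F≤D') (F' , F↝F' , H≤F') with reach-mono-≤ F≤D' F↝F'
  ... | E , D'↝E , F'≤E = E , D↝D' ◅◅ D'↝E , λ w → ≤-trans (H≤F' w) (F'≤E w)

  moves : ℕ → Fin (order G) → Fin (order G) → Distribution G → Distribution G
  moves zero    u v D = D
  moves (suc k) u v D = moves k u v (move G u v D)

  reach-moves : ∀ {u v} → Adj G u v → ∀ k {D} → 2 * k ≤ D u → Reach G D (moves k u v D)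
  reach-moves uv zero    _    = ε
  reach-moves {u} {v} uv (suc k) {D} 2k+2≤Du =
    step u v uv (m+n≤o⇒m≤o 2 2+2k≤Du) ◅ reach-moves uv k 2k≤Du∸2
    where
    2+2k≤Du : 2 + 2 * k ≤ D u
    2+2k≤Du = subst (_≤ D u) (*-suc 2 k) 2k+2≤Du
    2k≤Du∸2 : 2 * k ≤ move G u v D u
    2k≤Du∸2 = subst (2 * k ≤_) (sym (move-source D (adj⇒≢ uv)))
                (m+n≤o⇒m≤o∸n (2 * k) (subst (_≤ D u) (+-comm 2 (2 * k)) 2+2k≤Du))

  module _ {u v : Fin (order G)} (u≢v : u ≢ v) where

    moves-source : ∀ k D → moves k u v D u ≡ D u ∸ 2 * k
    moves-source zero    D = refl
    moves-source (suc k) D = begin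
      moves k u v (move G u v D) u  ≡⟨ moves-source k _ ⟩
      move G u v D u ∸ 2 * k        ≡⟨ cong (_∸ 2 * k) (move-source D u≢v) ⟩
      D u ∸ 2 ∸ 2 * k               ≡⟨ ∸-+-assoc (D u) 2 (2 * k) ⟩
      D u ∸ (2 + 2 * k)             ≡⟨ cong (D u ∸_) (*-suc 2 k) ⟨
      D u ∸ 2 * suc k               ∎
      where open ≡-Reasoning

    moves-target : ∀ k D → moves k u v D v ≡ D v + k
    moves-target zero    D = sym (+-identityʳ (D v))
    moves-target (suc k) D = begin
      moves k u v (move G u v D) v  ≡⟨ moves-target k _ ⟩
      move G u v D v + k            ≡⟨ cong (_+ k) (move-target D u≢v) ⟩
      D v + 1 + k                   ≡⟨ +-assoc (D v) 1 k ⟩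
      D v + suc k                   ∎
      where open ≡-Reasoning

    moves-other : ∀ k D {w} → w ≢ u → w ≢ v → moves k u v D w ≡ D w
    moves-other zero    D w≢u w≢v = refl
    moves-other (suc k) D w≢u w≢v = trans (moves-other k _ w≢u w≢v) (move-other D w≢u w≢v)

  weakReach-moves : ∀ {u v D} (H : Distribution G) → Adj G u v → ∀ k →
    H u + 2 * k ≤ D u → H v ≤ D v + k → (∀ w → w ≢ u → w ≢ v → H w ≤ D w) → WeakReach D H
  weakReach-moves {u} {v} {D} H uv k Hu Hv H-other =
    moves k u v D , reach-moves uv k (m+n≤o⇒n≤o (H u) Hu) , H≤moves
    where
    H≤moves : H ≤ᴰ moves k u v D
    H≤moves w with w ≟ u | w ≟ v
    ... | yes refl | _        = subst (H u ≤_) (sym (moves-source (adj⇒≢ uv) k D)) (m+n≤o⇒m≤o∸n (H u) Hu)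
    ... | no  _    | yes refl = subst (H v ≤_) (sym (moves-target (adj⇒≢ uv) k D)) Hv
    ... | no w≢u   | no w≢v   =
      subst (H w ≤_) (sym (moves-other (adj⇒≢ uv) k D w≢u w≢v)) (H-other w w≢u w≢v)

simulate : ∀ G H (f : Distribution G → Distribution H) →
  (∀ {D u v} → Adj G u v → 2 ≤ D u → WeakReach H (f D) (f (move G u v D))) →
  ∀ {D D'} → Reach G D D' → WeakReach H (f D) (f D')
simulate G H f f-step ε                      = weakReach-≤ᴰ H (λ _ → ≤-refl)
simulate G H f f-step (step u v uv 2≤Du ◅ r) = weakReach-trans H (f-step uv 2≤Du) (simulate G H f f-step r)

module Product (G H : Graph) where

  vertex-elim : {B : Fin (order (G □ H)) → Set} → (∀ a b → B (combine a b)) → ∀ x → B x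
  vertex-elim {B} B-combine x =
    subst B (combine-remQuot {order G} (order H) x) (uncurry B-combine (remQuot {order G} (order H) x))

  adj-combine : ∀ {a b a' b'} → Adj (G □ H) (combine a b) (combine a' b') → ProdAdj G H (a , b) (a' , b')
  adj-combine {a} {b} {a'} {b'} = subst₂ (ProdAdj G H) (remQuot-combine a b) (remQuot-combine a' b')

  combine-adj : ∀ {a b a' b'} → ProdAdj G H (a , b) (a' , b') → Adj (G □ H) (combine a b) (combine a' b')
  combine-adj {a} {b} {a'} {b'} = subst₂ (ProdAdj G H) (sym (remQuot-combine a b)) (sym (remQuot-combine a' b'))

  combine-≢ˡ : ∀ {a a' : Fin (order G)} {b b' : Fin (order H)} → a ≢ a' → combine a b ≢ combine a' b'
  combine-≢ˡ {a} {a'} {b} {b'} a≢a' eq = a≢a' (proj₁ (combine-injective a b a' b' eq))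

  combine-≢ʳ : ∀ {a a' : Fin (order G)} {b b' : Fin (order H)} → b ≢ b' → combine a b ≢ combine a' b'
  combine-≢ʳ {a} {a'} {b} {b'} b≢b' eq = b≢b' (proj₂ (combine-injective a b a' b' eq))

size-≡-sum : ∀ G (D : Distribution G) → size G D ≡ sum D
size-≡-sum G D = sum-tabulate D

module _ (G : Graph) (n : ℕ) where

  private
    P : Graph
    P = G □ K (suc n)

  open Product G (K (suc n))

  onLayer₀ : Distribution G → Fin (order G) → Fin (suc n) → ℕ
  onLayer₀ D a zero    = D a
  onLayer₀ D a (suc _) = 0

  embed : Distribution G → Distribution P
  embed D = uncurry (onLayer₀ D) ∘ remQuot {order G} (suc n)

  embed-combine : ∀ D a b → embed D (combine a b) ≡ onLayer₀ D a b
  embed-combine D a b = cong (uncurry (onLayer₀ D)) (remQuot-combine a b)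

  size-embed : ∀ D → size P (embed D) ≡ size G D
  size-embed D = begin
    size P (embed D)                                  ≡⟨ size-≡-sum P (embed D) ⟩
    sum (embed D)                                     ≡⟨ sum-combine (order G) (embed D) ⟩
    ∑[ a < order G ] ∑[ b < suc n ] embed D (combine a b)
      ≡⟨ sum-cong-≗ (λ a → sum-cong-≗ (embed-combine D a)) ⟩
    ∑[ a < order G ] (D a + ∑[ _ < n ] 0)
      ≡⟨ sum-cong-≗ (λ a → cong (D a +_) (sum-replicate-zero n)) ⟩
    ∑[ a < order G ] (D a + 0)                        ≡⟨ sum-cong-≗ (λ a → +-identityʳ (D a)) ⟩
    sum D                                             ≡⟨ size-≡-sum G D ⟨
    size G D                                          ∎
    where open ≡-Reasoning

  embed-step : ∀ {D u v} → Adj G u v → 2 ≤ D u → WeakReach P (embed D) (embed (move G u v D))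
  embed-step {D} {u} {v} uv 2≤Du =
    weakReach-moves P (embed D') (combine-adj (inj₂ (uv , refl))) 1 D'u D'v (vertex-elim D'-other)
    where
    D' : Distribution G
    D' = move G u v D
    D'u : embed D' (combine u zero) + 2 ≤ embed D (combine u zero)
    D'u rewrite embed-combine D' u zero | embed-combine D u zero | move-source G D (adj⇒≢ G uv) =
      ≤-reflexive (m∸n+n≡m 2≤Du)
    D'v : embed D' (combine v zero) ≤ embed D (combine v zero) + 1
    D'v rewrite embed-combine D' v zero | embed-combine D v zero = ≤-reflexive (move-target G D (adj⇒≢ G uv))
    D'-other : ∀ c j → combine c j ≢ combine u zero → combine c j ≢ combine v zero →
               embed D' (combine c j) ≤ embed D (combine c j)
    D'-other c j c≢u c≢v rewrite embed-combine D' c j | embed-combine D c j with j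
    ... | zero  = ≤-reflexive (move-other G D (c≢u ∘ cong (λ a → combine a zero))
                                                (c≢v ∘ cong (λ a → combine a zero)))
    ... | suc _ = z≤n

  embed-solvable : ∀ t D → Solvable G (2 * t) D → Solvable P t (embed D)
  embed-solvable t D D-solvable = vertex-elim reach
    where
    reach : ∀ a b → ∃ λ E → Reach P (embed D) E × t ≤ E (combine a b)
    reach a b with D-solvable a
    ... | D' , D↝D' , 2t≤D'a with simulate G P embed embed-step D↝D'
    ...   | E , D↝E , D'≤E = spread b
      where
      2t≤E : 2 * t ≤ E (combine a zero)
      2t≤E = ≤-trans 2t≤D'a (subst (_≤ E (combine a zero)) (embed-combine D' a zero) (D'≤E (combine a zero)))
      spread : ∀ b → ∃ λ E' → Reach P (embed D) E' × t ≤ E' (combine a b)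
      spread zero    = E , D↝E , ≤-trans (m≤m+n t (t + 0)) 2t≤E
      spread (suc j) =
        moves P t (combine a zero) (combine a (suc j)) E ,
        D↝E ◅◅ reach-moves P (combine-adj (inj₁ (refl , λ ()))) t 2t≤E ,
        subst (t ≤_) (sym (moves-target P (combine-≢ʳ λ ()) t E)) (m≤n+m t _)

  fibre : Distribution P → Fin (order G) → Fin (suc n) → ℕ
  fibre F a b = F (combine a b)

  layerSize : Distribution P → Fin (suc n) → ℕ
  layerSize F b = ∑[ a < order G ] fibre F a b

  sum-layerSize : ∀ F → sum (layerSize F) ≡ size P F
  sum-layerSize F = begin
    ∑[ b < suc n ] ∑[ a < order G ] fibre F a b  ≡⟨ ∑-comm (fibre F) ⟨
    ∑[ a < order G ] ∑[ b < suc n ] fibre F a b  ≡⟨ sum-combine (order G) F ⟨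
    sum F                                        ≡⟨ size-≡-sum P F ⟨
    size P F                                     ∎
    where open ≡-Reasoning

  module _ (i : Fin (suc n)) where

    project : Distribution P → Distribution G
    project F a = fibre F a i + sum (fibre F a)

    size-project : ∀ F → size G (project F) ≡ layerSize F i + size P F
    size-project F = begin
      size G (project F)                                ≡⟨ size-≡-sum G (project F) ⟩
      ∑[ a < order G ] (fibre F a i + sum (fibre F a))  ≡⟨ ∑-distrib-+ (λ a → fibre F a i) (sum ∘ fibre F) ⟩
      layerSize F i + ∑[ a < order G ] ∑[ b < suc n ] fibre F a b
        ≡⟨ cong (layerSize F i +_) (sum-combine (order G) F) ⟨
      layerSize F i + sum F                             ≡⟨ cong (layerSize F i +_) (size-≡-sum P F) ⟨
      layerSize F i + size P F                          ∎
      where open ≡-Reasoning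

    project-move-within-fibre : ∀ F a {b b'} → b ≢ b' → 2 ≤ F (combine a b) →
      project (move P (combine a b) (combine a b') F) ≤ᴰ project F
    project-move-within-fibre F a {b} {b'} b≢b' 2≤Fx c = bound (c ≟ a)
      where
      F' : Distribution P
      F' = move P (combine a b) (combine a b') F
      x≢y : combine a b ≢ combine a b'
      x≢y = combine-≢ʳ b≢b'
      sum≤ : sum (fibre F' a) + 2 ≤ sum (fibre F a) + 1
      sum≤ = sum-update₂-≤ b≢b'
        (λ j j≢b j≢b' → ≤-reflexive (move-other P F (combine-≢ʳ j≢b) (combine-≢ʳ j≢b')))
        (≤-reflexive (trans (cong (_+ 2) (move-source P F x≢y)) (m∸n+n≡m 2≤Fx)))
        (≤-reflexive (move-target P F x≢y))
      +-shuffle : ∀ x s → x + 1 + (s + 1) ≡ x + s + 2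
      +-shuffle = solve-∀
      bound : Dec (c ≡ a) → project F' c ≤ project F c
      bound (no c≢a) = ≤-reflexive (cong₂ _+_ (unchanged i) (sum-cong-≗ unchanged))
        where
        unchanged : ∀ j → fibre F' c j ≡ fibre F c j
        unchanged j = move-other P F (combine-≢ˡ c≢a) (combine-≢ˡ c≢a)
      bound (yes refl) = +-cancelʳ-≤ 2 _ _ (begin
        fibre F' a i + sum (fibre F' a) + 2      ≡⟨ +-assoc (fibre F' a i) _ 2 ⟩
        fibre F' a i + (sum (fibre F' a) + 2)    ≤⟨ +-mono-≤ (move-≤-+1 P F (combine a i)) sum≤ ⟩
        fibre F a i + 1 + (sum (fibre F a) + 1)  ≡⟨ +-shuffle (fibre F a i) (sum (fibre F a)) ⟩
        fibre F a i + sum (fibre F a) + 2        ∎)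
        where open ≤-Reasoning

    project-move-across : ∀ F {a a'} b → Adj G a a' → 2 ≤ F (combine a b) →
      WeakReach G (project F) (project (move P (combine a b) (combine a' b) F))
    project-move-across F {a} {a'} b aa' 2≤Fx = transfer (i ≟ b)
      where
      F' : Distribution P
      F' = move P (combine a b) (combine a' b) F
      a≢a' : a ≢ a'
      a≢a' = adj⇒≢ G aa'
      x≢y : combine a b ≢ combine a' b
      x≢y = combine-≢ˡ a≢a'
      F'x+2≡Fx : F' (combine a b) + 2 ≡ F (combine a b)
      F'x+2≡Fx = trans (cong (_+ 2) (move-source P F x≢y)) (m∸n+n≡m 2≤Fx)
      unchanged : ∀ c j → c ≢ a → c ≢ a' → fibre F' c j ≡ fibre F c j
      unchanged c j c≢a c≢a' = move-other P F (combine-≢ˡ c≢a) (combine-≢ˡ c≢a')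
      unchanged-off-b : ∀ c j → j ≢ b → fibre F' c j ≡ fibre F c j
      unchanged-off-b c j j≢b = move-other P F (combine-≢ʳ j≢b) (combine-≢ʳ j≢b)
      source-sum : sum (fibre F' a) + 2 ≤ sum (fibre F a) + 0
      source-sum = sum-update-≤ b (λ j j≢b → ≤-reflexive (unchanged-off-b a j j≢b))
        (≤-reflexive (trans F'x+2≡Fx (sym (+-identityʳ _))))
      target-sum : sum (fibre F' a') + 0 ≤ sum (fibre F a') + 1
      target-sum = sum-update-≤ b (λ j j≢b → ≤-reflexive (unchanged-off-b a' j j≢b))
        (≤-reflexive (trans (+-identityʳ _) (move-target P F x≢y)))
      -- e = 1 exactly when the move is inside layer i, whose pebbles project counts twice.
      transfer-with : ∀ e → fibre F' a i + 2 * e ≤ fibre F a i → fibre F' a' i ≤ fibre F a' i + e →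
                      WeakReach G (project F) (project F')
      transfer-with e source-i target-i = weakReach-moves G (project F') aa' (suc e) source target other
        where
        open ≤-Reasoning
        shuffle-source : ∀ x s e → x + s + 2 * suc e ≡ x + 2 * e + (s + 2)
        shuffle-source = solve-∀
        shuffle-target : ∀ x s e → x + e + (s + 1) ≡ x + s + suc e
        shuffle-target = solve-∀
        source : project F' a + 2 * suc e ≤ project F a
        source = begin
          fibre F' a i + sum (fibre F' a) + 2 * suc e    ≡⟨ shuffle-source (fibre F' a i) _ e ⟩
          fibre F' a i + 2 * e + (sum (fibre F' a) + 2)  ≤⟨ +-mono-≤ source-i source-sum ⟩
          fibre F a i + (sum (fibre F a) + 0)            ≡⟨ cong (fibre F a i +_) (+-identityʳ _) ⟩
          project F a                                    ∎
        target : project F' a' ≤ project F a' + suc e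
        target = begin
          fibre F' a' i + sum (fibre F' a')              ≡⟨ cong (fibre F' a' i +_) (+-identityʳ _) ⟨
          fibre F' a' i + (sum (fibre F' a') + 0)        ≤⟨ +-mono-≤ target-i target-sum ⟩
          fibre F a' i + e + (sum (fibre F a') + 1)      ≡⟨ shuffle-target (fibre F a' i) _ e ⟩
          project F a' + suc e                           ∎
        other : ∀ c → c ≢ a → c ≢ a' → project F' c ≤ project F c
        other c c≢a c≢a' =
          ≤-reflexive (cong₂ _+_ (unchanged c i c≢a c≢a') (sum-cong-≗ (λ j → unchanged c j c≢a c≢a')))
      transfer : Dec (i ≡ b) → WeakReach G (project F) (project F')
      transfer (yes refl) = transfer-with 1 (≤-reflexive F'x+2≡Fx) (≤-reflexive (move-target P F x≢y))
      transfer (no i≢b)   = transfer-with 0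
        (≤-reflexive (trans (+-identityʳ _) (unchanged-off-b a i i≢b)))
        (≤-reflexive (trans (unchanged-off-b a' i i≢b) (sym (+-identityʳ _))))

    project-step : ∀ {F x y} → Adj P x y → 2 ≤ F x → WeakReach G (project F) (project (move P x y F))
    project-step {F} {x} {y} = vertex-elim {B = Step-simulated} (λ a b → vertex-elim (by-cases a b)) x y
      where
      Step-simulated : Fin (order P) → Set
      Step-simulated x = ∀ y → Adj P x y → 2 ≤ F x → WeakReach G (project F) (project (move P x y F))
      by-cases : ∀ a b a' b' → Adj P (combine a b) (combine a' b') → 2 ≤ F (combine a b) →
                 WeakReach G (project F) (project (move P (combine a b) (combine a' b') F))
      by-cases a b a' b' xy with adj-combine {a} {b} {a'} {b'} xy
      ... | inj₁ (refl , b≢b') = weakReach-≤ᴰ G ∘ project-move-within-fibre F a b≢b'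
      ... | inj₂ (aa' , refl)  = project-move-across F b aa'

    project-solvable : ∀ t E → Solvable P t E → Solvable G (2 * t) (project E)
    project-solvable t E E-solvable v with E-solvable (combine v i)
    ... | E' , E↝E' , t≤E'vi with simulate P G project project-step E↝E'
    ...   | D' , E↝D' , E'≤D' = D' , E↝D' , ≤-trans 2t≤ (E'≤D' v)
      where
      2t≤ : 2 * t ≤ project E' v
      2t≤ = subst (_≤ project E' v) (cong (t +_) (sym (+-identityʳ t)))
              (+-mono-≤ t≤E'vi (≤-trans t≤E'vi (≤-sum (fibre E' v) i)))

⌈/suc⌉-≤ : ∀ {a c q} → a ≤ suc c * q → ⌈ a /suc c ⌉ ≤ q
⌈/suc⌉-≤ {a} {c} {q} a≤ = s≤s⁻¹ (m<n*o⇒m/o<n (begin-strict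
  a + c              ≤⟨ +-monoˡ-≤ c (≤-trans a≤ (≤-reflexive (*-comm (suc c) q))) ⟩
  q * suc c + c      ≡⟨ +-comm (q * suc c) c ⟩
  c + q * suc c      <⟨ n<1+n _ ⟩
  suc q * suc c      ∎))
  where open ≤-Reasoning

theorem3p1 : (G : Graph) (t n : ℕ) → 1 ≤ t → 1 ≤ n → (p q : ℕ) →
    IsOptPebbling G (2 * t) p → IsOptPebbling (G □ K n) t q →
    ⌈ n * p /suc n ⌉ ≤ q × q ≤ p
-- The missing case n = 0 is excluded by the empty hypothesis 1 ≤ 0.
theorem3p1 G t (suc n) _ _ p q
  ((D , D-solvable , |D|≡p) , p-optimal) ((E , E-solvable , |E|≡q) , q-optimal) =
  lower (∃-≤-average (layerSize G n E)) , upper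
  where
  upper : q ≤ p
  upper = subst (q ≤_) (trans (size-embed G n D) |D|≡p) (q-optimal _ (embed-solvable G n t D D-solvable))
  lower : (∃ λ i → suc n * layerSize G n E i ≤ sum (layerSize G n E)) →
          ⌈ suc n * p /suc suc n ⌉ ≤ q
  lower (i , average) = ⌈/suc⌉-≤ (begin
    suc n * p                   ≤⟨ *-monoʳ-≤ (suc n) p≤L+q ⟩
    suc n * (L + q)             ≡⟨ *-distribˡ-+ (suc n) L q ⟩
    suc n * L + suc n * q       ≤⟨ +-monoˡ-≤ (suc n * q) N*L≤q ⟩
    suc (suc n) * q             ∎)
    where
    open ≤-Reasoning
    L : ℕ
    L = layerSize G n E i
    N*L≤q : suc n * L ≤ q
    N*L≤q = subst (suc n * L ≤_) (trans (sum-layerSize G n E) |E|≡q) average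
    p≤L+q : p ≤ L + q
    p≤L+q = subst (p ≤_) (trans (size-project G n i E) (cong (L +_) |E|≡q))
              (p-optimal _ (project-solvable G n i t E E-solvable))
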